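{- For every natural number $x$, $$S_{17}(2^{17} x) = 34\, S_{17}(2^9 x) - 17\, S_{17}(2x).$$
   Context: For $m, x \in \mathbb{N}$, the Newman sum is $S_m(x)=\sum_{0\le n<x,\ n\equiv 0 \pmod m} (-1)^{\sigma(n)}$, where $\sigma(n)$ denotes the number of 1's in the binary expansion of $n$. -}

module Defs where

open import Data.Nat using (ℕ; zero; suc; _+_; _*_; _%_; _/_; _≡ᵇ_)
open import Data.Bool using (Bool; true; false; if_then_else_)
open import Data.Integer as ℤ using (ℤ; +_; -_)
open import Data.Nat.Divisibility using (_∣?_)
open import Relation.Nullary using (does)

-- number of 1's in the binary expansion, with fuel (fuel ≥ n suffices)
popcountAux : ℕ → ℕ → ℕ
popcountAux zero    n = 0
popcountAux (suc f) n = n % 2 + popcountAux f (n / 2)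

σ : ℕ → ℕ
σ n = popcountAux n n

sign : ℕ → ℤ
sign k = if (k % 2) ≡ᵇ 0 then + 1 else - (+ 1)

-- Newman sum  S_m(x) = Σ_{0 ≤ n < x, m ∣ n} (-1)^{σ(n)}
-- S m x sums over n = 0, 1, ..., x-1
S : ℕ → ℕ → ℤ
S m zero    = + 0
S m (suc x) = S m x ℤ.+ (if does (m ∣? x) then sign (σ x) else + 0)

module Submission where

-- Write t(n) = (-1)^σ(n). Since t(2n) = t(n) and t(2n+1) = -t(n), a sum Σ_{n<2y} t(n) v(n mod m)
-- of Thue–Morse signs weighted by a function v of the residue mod m equals Σ_{n<y} t(n) v'(n mod m)
-- with v'(a) = v(2a) - v(2a+1). Starting from the indicator of the residue 0, this expresses
-- S_m(2^k x) through the k-th iterate of v ↦ v'. For m = 17 the iterates are vectors of 17 integers,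
-- and the 17th one is 34 times the 9th minus 17 times the first, which is checked by evaluation.

open import Defs
open import Data.Nat using (ℕ; zero; suc; _+_; _*_; _^_; _%_; _/_; _≤_; _≟_; NonZero; z≤n; s≤s)
open import Data.Nat.Properties using (≤-refl; ≤-reflexive; ≤-trans; ≤-pred; *-identityˡ)
open import Data.Nat.DivMod
  using (_mod_; m≡m%n+[m/n]*n; [m+kn]%n≡m%n; m*n%n≡0; m*n/n≡m; m/n<m; m%n<n; +-distrib-/)
open import Data.Nat.Divisibility using (_∣?_; m%n≡0⇔n∣m)
import Data.Nat.Tactic.RingSolver as ℕ-Solver
open import Data.Fin using (toℕ)
open import Data.Fin.Properties using (toℕ-fromℕ<; fromℕ<-cong)
open import Data.Vec using (Vec; tabulate; lookup; zipWith)
open import Data.Vec.Properties using (lookup∘tabulate; lookup-zipWith)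
open import Data.Integer as ℤ using (ℤ; +_; -_)
open import Data.Integer.Properties using (*-identityʳ; *-zeroʳ)
import Data.Integer.Tactic.RingSolver as ℤ-Solver
open import Data.Bool using (true; false; if_then_else_)
open import Relation.Nullary using (does)
open import Relation.Nullary.Decidable using (does-⇔)
open import Relation.Binary.PropositionalEquality using (_≡_; refl; sym; trans; cong; cong₂)
open Relation.Binary.PropositionalEquality.≡-Reasoning

popcountAux-zero : ∀ f → popcountAux f 0 ≡ 0
popcountAux-zero zero    = refl
popcountAux-zero (suc f) = popcountAux-zero f

n≤1+f⇒n/2≤f : ∀ n f → n ≤ suc f → n / 2 ≤ f
n≤1+f⇒n/2≤f zero    f _         = z≤n
n≤1+f⇒n/2≤f (suc n) f (s≤s n≤f) = ≤-trans (≤-pred (m/n<m (suc n) 2 (s≤s (s≤s z≤n)))) n≤f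

popcountAux-fuel : ∀ f f′ n → n ≤ f → n ≤ f′ → popcountAux f n ≡ popcountAux f′ n
popcountAux-fuel zero    f′       zero _ _ = sym (popcountAux-zero f′)
popcountAux-fuel (suc f) zero     zero _ _ = popcountAux-zero (suc f)
popcountAux-fuel (suc f) (suc f′) n n≤f n≤f′ =
  cong (_+_ (n % 2)) (popcountAux-fuel f f′ (n / 2) (n≤1+f⇒n/2≤f n f n≤f) (n≤1+f⇒n/2≤f n f′ n≤f′))

σ-unfold : ∀ n → σ n ≡ n % 2 + σ (n / 2)
σ-unfold zero    = refl
σ-unfold (suc n) =
  cong (_+_ (suc n % 2)) (popcountAux-fuel n (suc n / 2) (suc n / 2) (n≤1+f⇒n/2≤f (suc n) n ≤-refl) ≤-refl)

σ-double : ∀ n → σ (n * 2) ≡ σ n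
σ-double n = begin
  σ (n * 2)                   ≡⟨ σ-unfold (n * 2) ⟩
  (n * 2) % 2 + σ (n * 2 / 2) ≡⟨ cong₂ _+_ (m*n%n≡0 n 2) (cong σ (m*n/n≡m n 2)) ⟩
  σ n                         ∎

σ-double+1 : ∀ n → σ (1 + n * 2) ≡ suc (σ n)
σ-double+1 n = begin
  σ (1 + n * 2)                           ≡⟨ σ-unfold (1 + n * 2) ⟩
  (1 + n * 2) % 2 + σ ((1 + n * 2) / 2)   ≡⟨ cong₂ _+_ ([m+kn]%n≡m%n 1 n 2) (cong σ half) ⟩
  suc (σ n)                               ∎
  where
  half : (1 + n * 2) / 2 ≡ n
  half = trans (+-distrib-/ 1 (n * 2) (s≤s (s≤s (≤-reflexive (m*n%n≡0 n 2))))) (m*n/n≡m n 2)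

-- suc (suc k) % 2 and k % 2 reduce to the same mod-helper call, so the last clause is definitional.
sign-suc : ∀ k → sign (suc k) ≡ - sign k
sign-suc zero          = refl
sign-suc (suc zero)    = refl
sign-suc (suc (suc k)) = sign-suc k

thueMorse : ℕ → ℤ
thueMorse n = sign (σ n)

thueMorse-double : ∀ n → thueMorse (n * 2) ≡ thueMorse n
thueMorse-double n = cong sign (σ-double n)

thueMorse-double+1 : ∀ n → thueMorse (1 + n * 2) ≡ - thueMorse n
thueMorse-double+1 n = trans (cong sign (σ-double+1 n)) (sign-suc (σ n))

module ResidueWeighted (m : ℕ) .{{_ : NonZero m}} where

  Weights : Set
  Weights = Vec ℤ m

  twistedSum : Weights → ℕ → ℤ
  twistedSum v zero    = + 0
  twistedSum v (suc n) = twistedSum v n ℤ.+ thueMorse n ℤ.* lookup v (n mod m)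

  halve : Weights → Weights
  halve v = tabulate λ i → lookup v ((toℕ i * 2) mod m) ℤ.- lookup v ((1 + toℕ i * 2) mod m)

  indicator₀ : Weights
  indicator₀ = tabulate λ i → if does (toℕ i ≟ 0) then + 1 else + 0

  weights : ℕ → Weights
  weights zero    = indicator₀
  weights (suc k) = halve (weights k)

  mod-absorbs-% : ∀ r k n → (r + n % m * k) mod m ≡ (r + n * k) mod m
  mod-absorbs-% r k n = fromℕ<-cong _ _ %-eq _ _
    where
    regroup : ∀ r k a b d → r + a * k + b * k * d ≡ r + (a + b * d) * k
    regroup = ℕ-Solver.solve-∀

    %-eq : (r + n % m * k) % m ≡ (r + n * k) % m
    %-eq = begin
      (r + n % m * k) % m                   ≡⟨ sym ([m+kn]%n≡m%n _ (n / m * k) m) ⟩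
      (r + n % m * k + n / m * k * m) % m   ≡⟨ cong (_% m) (regroup r k (n % m) (n / m) m) ⟩
      (r + (n % m + n / m * m) * k) % m     ≡⟨ cong (λ a → (r + a * k) % m) (sym (m≡m%n+[m/n]*n n m)) ⟩
      (r + n * k) % m                       ∎

  lookup-halve : ∀ v n →
    lookup (halve v) (n mod m) ≡ lookup v ((n * 2) mod m) ℤ.- lookup v ((1 + n * 2) mod m)
  lookup-halve v n = begin
    lookup (halve v) (n mod m)
      ≡⟨ lookup∘tabulate _ (n mod m) ⟩
    lookup v ((toℕ (n mod m) * 2) mod m) ℤ.- lookup v ((1 + toℕ (n mod m) * 2) mod m)
      ≡⟨ cong (λ a → lookup v ((a * 2) mod m) ℤ.- lookup v ((1 + a * 2) mod m)) (toℕ-fromℕ< (m%n<n n m)) ⟩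
    lookup v ((n % m * 2) mod m) ℤ.- lookup v ((1 + n % m * 2) mod m)
      ≡⟨ cong₂ (λ i j → lookup v i ℤ.- lookup v j) (mod-absorbs-% 0 2 n) (mod-absorbs-% 1 2 n) ⟩
    lookup v ((n * 2) mod m) ℤ.- lookup v ((1 + n * 2) mod m)
      ∎

  twistedSum-double : ∀ v y → twistedSum v (y * 2) ≡ twistedSum (halve v) y
  twistedSum-double v zero    = refl
  twistedSum-double v (suc y) = begin
    twistedSum v (y * 2) ℤ.+ thueMorse (y * 2) ℤ.* p ℤ.+ thueMorse (1 + y * 2) ℤ.* q
      ≡⟨ cong₂ (λ s s′ → twistedSum v (y * 2) ℤ.+ s ℤ.* p ℤ.+ s′ ℤ.* q)
               (thueMorse-double y) (thueMorse-double+1 y) ⟩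
    twistedSum v (y * 2) ℤ.+ thueMorse y ℤ.* p ℤ.+ (- thueMorse y) ℤ.* q
      ≡⟨ collect (twistedSum v (y * 2)) (thueMorse y) p q ⟩
    twistedSum v (y * 2) ℤ.+ thueMorse y ℤ.* (p ℤ.- q)
      ≡⟨ cong₂ (λ s d → s ℤ.+ thueMorse y ℤ.* d) (twistedSum-double v y) (sym (lookup-halve v y)) ⟩
    twistedSum (halve v) y ℤ.+ thueMorse y ℤ.* lookup (halve v) (y mod m)
      ∎
    where
    p q : ℤ
    p = lookup v ((y * 2) mod m)
    q = lookup v ((1 + y * 2) mod m)

    collect : ∀ a s p q → a ℤ.+ s ℤ.* p ℤ.+ (- s) ℤ.* q ≡ a ℤ.+ s ℤ.* (p ℤ.- q)
    collect = ℤ-Solver.solve-∀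

  if-then-else-zero : ∀ b a → (if b then a else + 0) ≡ a ℤ.* (if b then + 1 else + 0)
  if-then-else-zero true  a = sym (*-identityʳ a)
  if-then-else-zero false a = sym (*-zeroʳ a)

  S≡twistedSum-indicator₀ : ∀ x → S m x ≡ twistedSum indicator₀ x
  S≡twistedSum-indicator₀ zero    = refl
  S≡twistedSum-indicator₀ (suc x) = cong₂ ℤ._+_ (S≡twistedSum-indicator₀ x) multipleTerm
    where
    multipleTerm : (if does (m ∣? x) then thueMorse x else + 0) ≡ thueMorse x ℤ.* lookup indicator₀ (x mod m)
    multipleTerm = begin
      (if does (m ∣? x) then thueMorse x else + 0)
        ≡⟨ cong (λ b → if b then thueMorse x else + 0) (sym (does-⇔ (m%n≡0⇔n∣m x m) (x % m ≟ 0) (m ∣? x))) ⟩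
      (if does (x % m ≟ 0) then thueMorse x else + 0)
        ≡⟨ if-then-else-zero (does (x % m ≟ 0)) (thueMorse x) ⟩
      thueMorse x ℤ.* (if does (x % m ≟ 0) then + 1 else + 0)
        ≡⟨ cong (λ a → thueMorse x ℤ.* (if does (a ≟ 0) then + 1 else + 0)) (sym (toℕ-fromℕ< (m%n<n x m))) ⟩
      thueMorse x ℤ.* (if does (toℕ (x mod m) ≟ 0) then + 1 else + 0)
        ≡⟨ cong (thueMorse x ℤ.*_) (sym (lookup∘tabulate _ (x mod m))) ⟩
      thueMorse x ℤ.* lookup indicator₀ (x mod m)
        ∎

  S[2^k*x]≡twistedSum-weights : ∀ k x → S m (2 ^ k * x) ≡ twistedSum (weights k) x
  S[2^k*x]≡twistedSum-weights zero    x = trans (cong (S m) (*-identityˡ x)) (S≡twistedSum-indicator₀ x)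
  S[2^k*x]≡twistedSum-weights (suc k) x = begin
    S m (2 ^ suc k * x)            ≡⟨ cong (S m) (shift (2 ^ k) x) ⟩
    S m (2 ^ k * (x * 2))          ≡⟨ S[2^k*x]≡twistedSum-weights k (x * 2) ⟩
    twistedSum (weights k) (x * 2) ≡⟨ twistedSum-double (weights k) x ⟩
    twistedSum (weights (suc k)) x ∎
    where
    shift : ∀ a x → 2 * a * x ≡ a * (x * 2)
    shift = ℕ-Solver.solve-∀

  twistedSum-lincomb : ∀ a b v w x →
    twistedSum (zipWith (λ p q → a ℤ.* p ℤ.- b ℤ.* q) v w) x ≡ a ℤ.* twistedSum v x ℤ.- b ℤ.* twistedSum w x
  twistedSum-lincomb a b v w zero    = zeroes a b
    where
    zeroes : ∀ a b → + 0 ≡ a ℤ.* + 0 ℤ.- b ℤ.* + 0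
    zeroes = ℤ-Solver.solve-∀
  twistedSum-lincomb a b v w (suc x) = begin
    twistedSum u x ℤ.+ thueMorse x ℤ.* lookup u (x mod m)
      ≡⟨ cong₂ (λ s l → s ℤ.+ thueMorse x ℤ.* l) (twistedSum-lincomb a b v w x) (lookup-zipWith _ (x mod m) v w) ⟩
    a ℤ.* twistedSum v x ℤ.- b ℤ.* twistedSum w x ℤ.+ thueMorse x ℤ.* (a ℤ.* p ℤ.- b ℤ.* q)
      ≡⟨ distribute a b (twistedSum v x) (twistedSum w x) (thueMorse x) p q ⟩
    a ℤ.* twistedSum v (suc x) ℤ.- b ℤ.* twistedSum w (suc x)
      ∎
    where
    u : Weights
    u = zipWith (λ p q → a ℤ.* p ℤ.- b ℤ.* q) v w
    p q : ℤ
    p = lookup v (x mod m)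
    q = lookup w (x mod m)

    distribute : ∀ a b V W s p q →
      a ℤ.* V ℤ.- b ℤ.* W ℤ.+ s ℤ.* (a ℤ.* p ℤ.- b ℤ.* q) ≡ a ℤ.* (V ℤ.+ s ℤ.* p) ℤ.- b ℤ.* (W ℤ.+ s ℤ.* q)
    distribute = ℤ-Solver.solve-∀

open ResidueWeighted 17

weights-17 : weights 17 ≡ zipWith (λ p q → + 34 ℤ.* p ℤ.- + 17 ℤ.* q) (weights 9) (weights 1)
weights-17 = refl

theorem3 : ∀ (x : ℕ) →
    S 17 (2 ^ 17 * x) ≡ (+ 34) ℤ.* S 17 (2 ^ 9 * x) ℤ.- (+ 17) ℤ.* S 17 (2 * x)
theorem3 x = begin
  S 17 (2 ^ 17 * x)
    ≡⟨ S[2^k*x]≡twistedSum-weights 17 x ⟩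
  twistedSum (weights 17) x
    ≡⟨ cong (λ v → twistedSum v x) weights-17 ⟩
  twistedSum (zipWith (λ p q → + 34 ℤ.* p ℤ.- + 17 ℤ.* q) (weights 9) (weights 1)) x
    ≡⟨ twistedSum-lincomb (+ 34) (+ 17) (weights 9) (weights 1) x ⟩
  + 34 ℤ.* twistedSum (weights 9) x ℤ.- + 17 ℤ.* twistedSum (weights 1) x
    ≡⟨ sym (cong₂ (λ s s′ → + 34 ℤ.* s ℤ.- + 17 ℤ.* s′)
                  (S[2^k*x]≡twistedSum-weights 9 x) (S[2^k*x]≡twistedSum-weights 1 x)) ⟩
  (+ 34) ℤ.* S 17 (2 ^ 9 * x) ℤ.- (+ 17) ℤ.* S 17 (2 * x)
    ∎
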